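{- Let $\langle R,\circ,e\rangle$ be a BBI-model and let $\overline{R}=\{\overline{r}\mid r\in R\}$ be a disjoint copy of $R$. Define $-x=\overline{x}$ for $x\in R$ and $-\overline{x}=x$ for $\overline{x}\in\overline{R}$. Let $\oplus:(R\cup\overline{R})\times(R\cup\overline{R})\to\mathcal{P}(R\cup\overline{R})$ be the least relation such that, for all $x,y,z\in R$ with $z\in x\circ y$: (i) $z\in x\oplus y$, and (ii) $\overline{y}\in x\oplus\overline{z}$ and $\overline{y}\in\overline{z}\oplus x$. Then $\langle R\cup\overline{R},\oplus,e,-,\overline{e}\rangle$ is a CBI-model. Moreover, the construction sending $\langle R,\circ,e\rangle$ to $\langle R\cup\overline{R},\oplus,e,-,\overline{e}\rangle$ is injective.
   Context: A BBI-model is $\langle R,\circ,e\rangle$ with $e\in R$, $\circ:R\times R\to\mathcal{P}(R)$ commutative and associative (w.r.t. the pointwise extension $X\circ Y=\bigcup_{x\in X,y\in Y}x\circ y$) with $r\circ e=\{r\}$ for all $r$. A CBI-model is $\langle R,\circ,e,-,\infty\rangle$ with $\langle R,\circ,e\rangle$ a BBI-model, $-:R\to R$, $\infty\in R$, such that for each $x$, $-x$ is the unique element with $\infty\in x\circ(-x)$. -}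

module Defs where

open import Data.Product using (Σ; _×_)
open import Data.Sum using (_⊎_; inj₁; inj₂)
open import Relation.Binary.PropositionalEquality using (_≡_)
open import Function.Bundles using (_⇔_)

-- A multi-valued binary operation ∘ : R × R → P(R) is represented as a
-- ternary relation  Op x y z  meaning  z ∈ x ∘ y.
Op : Set → Set₁
Op R = R → R → R → Set

-- BBI-model ⟨R, ∘, e⟩ (set equalities are membership equivalences)
record IsBBIModel {R : Set} (_∘_∋_ : Op R) (e : R) : Set where
  field
    comm  : ∀ x y z → (x ∘ y ∋ z) ⇔ (y ∘ x ∋ z)
    assoc : ∀ x y z w →
            (Σ R λ u → (x ∘ y ∋ u) × (u ∘ z ∋ w)) ⇔
            (Σ R λ u → (y ∘ z ∋ u) × (x ∘ u ∋ w))
    unit  : ∀ r z → (r ∘ e ∋ z) ⇔ (z ≡ r)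

record IsCBIModel {R : Set} (_∘_∋_ : Op R) (e : R) (-_ : R → R) (∞ : R) : Set where
  field
    isBBI    : IsBBIModel _∘_∋_ e
    neg-in   : ∀ x → x ∘ (- x) ∋ ∞
    neg-uniq : ∀ x y → x ∘ y ∋ ∞ → y ≡ - x

-- R ∪ R̄ is R ⊎ R, with inj₁ r = r and inj₂ r = r̄.
bar : {R : Set} → R ⊎ R → R ⊎ R
bar (inj₁ x) = inj₂ x
bar (inj₂ x) = inj₁ x

data Oplus {R : Set} (_∘_∋_ : Op R) : Op (R ⊎ R) where
  rule-i   : ∀ {x y z} → x ∘ y ∋ z → Oplus _∘_∋_ (inj₁ x) (inj₁ y) (inj₁ z)
  rule-iiL : ∀ {x y z} → x ∘ y ∋ z → Oplus _∘_∋_ (inj₁ x) (inj₂ z) (inj₂ y)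
  rule-iiR : ∀ {x y z} → x ∘ y ∋ z → Oplus _∘_∋_ (inj₂ z) (inj₁ x) (inj₂ y)

-- Write  (a ∘ b) ∘ c ∋ w  for "w ∈ (a ∘ b) ∘ c".  In a commutative associative
-- multi-valued operation this triple product is invariant under every
-- permutation of a, b, c; we record the permutations we need once, in
-- `TripleProduct`.  Each clause (ii) of ⊕ turns a product z ∈ x ∘ y into a
-- statement with a barred element moved across, so every associativity case
-- of ⊕ (organised by which of the arguments are barred) reduces to one triple
-- product in R read in a permuted order.
-- For injectivity we note that ⊕ restricted to unbarred elements is exactly ∘
-- (`oplus-on-R`), so ⊕ (together with e) recovers ⟨R, ∘, e⟩.
module Submission where

open import Defs
open import Data.Product using (Σ; _×_; _,_)
open import Data.Sum using (_⊎_; inj₁; inj₂)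
open import Relation.Binary.PropositionalEquality using (_≡_; refl; sym; cong)
open import Function.Bundles using (_⇔_; mk⇔; Equivalence)
open Equivalence using (to; from)

module TripleProduct {R : Set} (_∘_∋_ : Op R)
  (comm  : ∀ x y z → (x ∘ y ∋ z) ⇔ (y ∘ x ∋ z))
  (assoc : ∀ x y z w →
           (Σ R λ u → (x ∘ y ∋ u) × (u ∘ z ∋ w)) ⇔
           (Σ R λ u → (y ∘ z ∋ u) × (x ∘ u ∋ w)))
  where

  Triple : R → R → R → R → Set
  Triple a b c w = Σ R λ u → (a ∘ b ∋ u) × (u ∘ c ∋ w)

  swap : ∀ {x y z} → x ∘ y ∋ z → y ∘ x ∋ z
  swap {x} {y} {z} = to (comm x y z)

  swap₁₂ : ∀ {a b c w} → Triple a b c w → Triple b a c w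
  swap₁₂ (u , ab∋u , uc∋w) = u , swap ab∋u , uc∋w

  -- (a ∘ b) ∘ c = a ∘ (b ∘ c) = (b ∘ c) ∘ a
  rotate : ∀ {a b c w} → Triple a b c w → Triple b c a w
  rotate {a} {b} {c} {w} t with to (assoc a b c w) t
  ... | v , bc∋v , av∋w = v , bc∋v , swap av∋w

  swap₂₃ : ∀ {a b c w} → Triple a b c w → Triple a c b w
  swap₂₃ t = rotate (swap₁₂ t)

  swap₁₃ : ∀ {a b c w} → Triple a b c w → Triple c b a w
  swap₁₃ t = swap₁₂ (rotate t)

module InvolutiveExtension {R : Set} (_∘_∋_ : Op R) (e : R)
  (bbi : IsBBIModel _∘_∋_ e) where

  open IsBBIModel bbi
  open TripleProduct _∘_∋_ comm assoc

  _⊕_∋_ : Op (R ⊎ R)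
  _⊕_∋_ = Oplus _∘_∋_

  ⊕-comm : ∀ {x y z} → x ⊕ y ∋ z → y ⊕ x ∋ z
  ⊕-comm (rule-i p)   = rule-i (swap p)
  ⊕-comm (rule-iiL p) = rule-iiR p
  ⊕-comm (rule-iiR p) = rule-iiL p

  ⊕-assoc-to : ∀ {x y z w} →
    Σ (R ⊎ R) (λ u → (x ⊕ y ∋ u) × (u ⊕ z ∋ w)) →
    Σ (R ⊎ R) (λ u → (y ⊕ z ∋ u) × (x ⊕ u ∋ w))
  ⊕-assoc-to {inj₁ a} {inj₁ b} {inj₁ c} {inj₁ w} (_ , rule-i p , rule-i q)
    with to (assoc a b c w) (_ , p , q)
  ... | v , bc∋v , av∋w = inj₁ v , rule-i bc∋v , rule-i av∋w
  -- x, y ∈ R, z = c̄, w = w̄ :  c ∈ (a ∘ b) ∘ w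
  ⊕-assoc-to (_ , rule-i p , rule-iiL q) with swap₂₃ (_ , p , q)
  ... | v , aw∋v , vb∋c = inj₂ v , rule-iiL (swap vb∋c) , rule-iiL aw∋v
  -- x ∈ R, y = ȳ :  y ∈ (c ∘ w) ∘ a  (so w is barred, z ∈ R)
  ⊕-assoc-to (_ , rule-iiL p , rule-iiR q) with swap₁₃ (_ , q , swap p)
  ... | v , aw∋v , vc∋y = inj₂ v , rule-iiR (swap vc∋y) , rule-iiL aw∋v
  -- x = x̄ :  x ∈ (c ∘ w) ∘ b
  ⊕-assoc-to (_ , rule-iiR p , rule-iiR q) with rotate (rotate (_ , q , swap p))
  ... | v , bc∋v , vw∋x = inj₁ v , rule-i bc∋v , rule-iiR vw∋x

  ⊕-assoc-from : ∀ {x y z w} →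
    Σ (R ⊎ R) (λ u → (y ⊕ z ∋ u) × (x ⊕ u ∋ w)) →
    Σ (R ⊎ R) (λ u → (x ⊕ y ∋ u) × (u ⊕ z ∋ w))
  ⊕-assoc-from {inj₁ a} {inj₁ b} {inj₁ c} {inj₁ w} (_ , rule-i p , rule-i q)
    with from (assoc a b c w) (_ , p , q)
  ... | v , ab∋v , vc∋w = inj₁ v , rule-i ab∋v , rule-i vc∋w
  ⊕-assoc-from (_ , rule-iiL p , rule-iiL q) with swap₂₃ (_ , q , swap p)
  ... | v , ab∋v , vw∋c = inj₁ v , rule-i ab∋v , rule-iiL vw∋c
  ⊕-assoc-from (_ , rule-iiR p , rule-iiL q) with swap₁₃ (_ , q , swap p)
  ... | v , cw∋v , va∋y = inj₂ v , rule-iiL (swap va∋y) , rule-iiR cw∋v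
  ⊕-assoc-from (_ , rule-i p , rule-iiR q) with rotate (_ , p , q)
  ... | v , cw∋v , vb∋x = inj₂ v , rule-iiR (swap vb∋x) , rule-iiR cw∋v

  -- r ⊕ e = {r}: for r̄ this is the unit law read as  r ∈ y ∘ e ⇔ y ≡ r.
  ⊕-unit-to : ∀ r z → r ⊕ inj₁ e ∋ z → z ≡ r
  ⊕-unit-to (inj₁ a) (inj₁ c) (rule-i p)   = cong inj₁ (to (unit a c) p)
  ⊕-unit-to (inj₂ a) (inj₂ y) (rule-iiR p) = cong inj₂ (sym (to (unit y a) (swap p)))

  ⊕-unit-from : ∀ r z → z ≡ r → r ⊕ inj₁ e ∋ z
  ⊕-unit-from (inj₁ a) _ refl = rule-i (from (unit a a) refl)
  ⊕-unit-from (inj₂ a) _ refl = rule-iiR (swap (from (unit a a) refl))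

  -- ē ∈ x ⊕ (-x), from a ∈ a ∘ e.
  ⊕-neg-in : ∀ x → x ⊕ bar x ∋ inj₂ e
  ⊕-neg-in (inj₁ a) = rule-iiL (from (unit a a) refl)
  ⊕-neg-in (inj₂ a) = rule-iiR (from (unit a a) refl)

  ⊕-neg-uniq : ∀ x y → x ⊕ y ∋ inj₂ e → y ≡ bar x
  ⊕-neg-uniq (inj₁ a) (inj₂ z) (rule-iiL p) = cong inj₂ (to (unit a z) p)
  ⊕-neg-uniq (inj₂ z) (inj₁ a) (rule-iiR p) = cong inj₁ (sym (to (unit a z) p))

  isCBIModel : IsCBIModel _⊕_∋_ (inj₁ e) bar (inj₂ e)
  isCBIModel = record
    { isBBI = record
      { comm  = λ _ _ _ → mk⇔ ⊕-comm ⊕-comm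
      ; assoc = λ _ _ _ _ → mk⇔ ⊕-assoc-to ⊕-assoc-from
      ; unit  = λ r z → mk⇔ (⊕-unit-to r z) (⊕-unit-from r z)
      }
    ; neg-in   = ⊕-neg-in
    ; neg-uniq = ⊕-neg-uniq
    }

oplus-on-R : ∀ {R : Set} (o : Op R) x y z → Oplus o (inj₁ x) (inj₁ y) (inj₁ z) ⇔ o x y z
oplus-on-R o x y z = mk⇔ (λ { (rule-i p) → p }) rule-i

oplus-injective : ∀ {R : Set} (o₁ o₂ : Op R) →
  (∀ a b c → Oplus o₁ a b c ⇔ Oplus o₂ a b c) → ∀ x y z → o₁ x y z ⇔ o₂ x y z
oplus-injective o₁ o₂ same x y z = mk⇔
  (λ p → to (oplus-on-R o₂ x y z) (to (same _ _ _) (from (oplus-on-R o₁ x y z) p)))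
  (λ p → to (oplus-on-R o₁ x y z) (from (same _ _ _) (from (oplus-on-R o₂ x y z) p)))

proposition5p13 :
    ((R : Set) (_∘_∋_ : Op R) (e : R) → IsBBIModel _∘_∋_ e →
      IsCBIModel (Oplus _∘_∋_) (inj₁ e) bar (inj₂ e))
    ×
    ((R : Set) (o₁ o₂ : Op R) (e₁ e₂ : R) →
      IsBBIModel o₁ e₁ → IsBBIModel o₂ e₂ →
      (∀ a b c → Oplus o₁ a b c ⇔ Oplus o₂ a b c) →
      _≡_ {A = R ⊎ R} (inj₁ e₁) (inj₁ e₂) →
      _≡_ {A = R ⊎ R} (inj₂ e₁) (inj₂ e₂) →
      (e₁ ≡ e₂) × (∀ x y z → o₁ x y z ⇔ o₂ x y z))
proposition5p13 =
  (λ R _∘_∋_ e bbi → InvolutiveExtension.isCBIModel _∘_∋_ e bbi) ,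
  (λ R o₁ o₂ e₁ e₂ _ _ same → λ { refl _ → refl , oplus-injective o₁ o₂ same })
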